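{- Let $q$ be a prime power, $K\subseteq\mathbb{F}_q^3$ a Kakeya set, and let \[ A=\{(\alpha_1,\alpha_2,\alpha_3)\in\mathbb{Z}_{\geq 0}^3 : \alpha_1+\alpha_2+\alpha_3<2q,\ \alpha_1<q,\ \alpha_2<q\},\qquad V=\Bigl\{\sum_{\alpha\in A}c_\alpha x^\alpha : c_\alpha\in\mathbb{F}_q\Bigr\}\subseteq\mathbb{F}_q[x_1,x_2,x_3]. \] If $P\in V$ vanishes to order $2$ at every point of $K$, then $P=0$.
   Context: A set $K\subseteq\mathbb{F}_q^3$ is a Kakeya set if for every $b\in\mathbb{F}_q^3\setminus\{0\}$ there exists $a\in\mathbb{F}_q^3$ such that $\{a+bt: t\in\mathbb{F}_q\}\subseteq K$. Here $x^\alpha=x_1^{\alpha_1}x_2^{\alpha_2}x_3^{\alpha_3}$. A polynomial $P\in\mathbb{F}_q[x_1,x_2,x_3]$ vanishes at $p\in\mathbb{F}_q^3$ to order $2$ if $P(p)=0$ and $\nabla P(p)=0$, where $\nabla P=(\partial P/\partial x_1,\partial P/\partial x_2,\partial P/\partial x_3)$ is the vector of formal partial derivatives. -}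

module Defs where

open import Level using (Level; _⊔_)
open import Data.Nat as ℕ using (ℕ; zero; suc; _<_; _∸_)
open import Data.Nat.Primality using (Prime)
open import Data.Fin using (Fin; toℕ)
open import Data.Product using (Σ; ∃; _×_; _,_)
open import Relation.Nullary using (¬_)
open import Algebra.Bundles using (CommutativeRing; Semiring)
import Algebra.Definitions.RawSemiring as RS

IsPrimePower : ℕ → Set
IsPrimePower q = Σ ℕ λ p → Σ ℕ λ k → Prime p × (1 ℕ.≤ k) × (q ≡ℕ p ℕ.^ k)
  where open import Relation.Binary.PropositionalEquality renaming (_≡_ to _≡ℕ_)

module _ {c ℓ : Level} (R : CommutativeRing c ℓ) where
  open CommutativeRing R
  open RS (Semiring.rawSemiring semiring) using (_^_) renaming (_×_ to _·ℕ_)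

  IsField : Set (c ⊔ ℓ)
  IsField = (¬ (1# ≈ 0#)) Data.Product.× (∀ x → ¬ (x ≈ 0#) → ∃ λ y → (x * y) ≈ 1#)

  HasCard : ℕ → Set (c ⊔ ℓ)
  HasCard q = Σ (Fin q → Carrier) λ e →
      (∀ i j → e i ≈ e j → i ≡ j) Data.Product.× (∀ x → ∃ λ i → e i ≈ x)
    where open import Relation.Binary.PropositionalEquality using (_≡_)

  Point : Set c
  Point = Carrier Data.Product.× Carrier Data.Product.× Carrier

  line : Point → Point → Carrier → Point
  line (a₁ , a₂ , a₃) (b₁ , b₂ , b₃) t = (a₁ + t * b₁ , a₂ + t * b₂ , a₃ + t * b₃)

  IsKakeya : (Point → Set ℓ) → Set (c ⊔ ℓ)
  IsKakeya K = ∀ (b : Point) → ¬ (b ≡₀) → ∃ λ (a : Point) → ∀ t → K (line a b t)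
    where
      _≡₀ : Point → Set ℓ
      (b₁ , b₂ , b₃) ≡₀ = (b₁ ≈ 0#) Data.Product.× (b₂ ≈ 0#) Data.Product.× (b₃ ≈ 0#)

  sumTo : ℕ → (ℕ → Carrier) → Carrier
  sumTo zero f = 0#
  sumTo (suc n) f = sumTo n f + f n

  Exps : Set
  Exps = ℕ Data.Product.× ℕ Data.Product.× ℕ

  InA : ℕ → Exps → Set
  InA q (α₁ , α₂ , α₃) = (α₁ ℕ.+ α₂ ℕ.+ α₃ < 2 ℕ.* q) Data.Product.× (α₁ < q) Data.Product.× (α₂ < q)

  -- Σ_{α ∈ A} g α   (α₁ < q, α₂ < q, α₃ < 2q ∸ (α₁+α₂), which is exactly A)
  sumA : ℕ → (Exps → Carrier) → Carrier
  sumA q g = sumTo q λ α₁ → sumTo q λ α₂ → sumTo (2 ℕ.* q ∸ (α₁ ℕ.+ α₂)) λ α₃ → g (α₁ , α₂ , α₃)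

  -- polynomial P = Σ_{α∈A} c_α x^α in V, given by coefficients c (only values on A matter)
  Coeffs : Set c
  Coeffs = Exps → Carrier

  eval : ℕ → Coeffs → Point → Carrier
  eval q cf (x₁ , x₂ , x₃) = sumA q λ { (α₁ , α₂ , α₃) →
    cf (α₁ , α₂ , α₃) * ((x₁ ^ α₁) * (x₂ ^ α₂) * (x₃ ^ α₃)) }

  -- x^(n-1) with the convention that the term is multiplied by n, so n = 0 is harmless
  pred^ : Carrier → ℕ → Carrier
  pred^ x n = x ^ (n ∸ 1)

  ∂₁ ∂₂ ∂₃ : ℕ → Coeffs → Point → Carrier
  ∂₁ q cf (x₁ , x₂ , x₃) = sumA q λ { (α₁ , α₂ , α₃) →
    cf (α₁ , α₂ , α₃) * ((α₁ ·ℕ 1#) * ((pred^ x₁ α₁) * (x₂ ^ α₂) * (x₃ ^ α₃))) }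
  ∂₂ q cf (x₁ , x₂ , x₃) = sumA q λ { (α₁ , α₂ , α₃) →
    cf (α₁ , α₂ , α₃) * ((α₂ ·ℕ 1#) * ((x₁ ^ α₁) * (pred^ x₂ α₂) * (x₃ ^ α₃))) }
  ∂₃ q cf (x₁ , x₂ , x₃) = sumA q λ { (α₁ , α₂ , α₃) →
    cf (α₁ , α₂ , α₃) * ((α₃ ·ℕ 1#) * ((x₁ ^ α₁) * (x₂ ^ α₂) * (pred^ x₃ α₃))) }

  VanishesOrder2 : ℕ → Coeffs → Point → Set ℓ
  VanishesOrder2 q cf p = (eval q cf p ≈ 0#) Data.Product.×
    ((∂₁ q cf p ≈ 0#) Data.Product.× (∂₂ q cf p ≈ 0#) Data.Product.× (∂₃ q cf p ≈ 0#))

  IsZeroPoly : ℕ → Coeffs → Set ℓ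
  IsZeroPoly q cf = ∀ α → InA q α → cf α ≈ 0#

{-# OPTIONS --safe #-}
module Submission where

open import Defs
open import Level using (Level; _⊔_)
open import Data.Nat using (ℕ)
open import Algebra.Bundles using (CommutativeRing)

open import Data.Nat as ℕ using (zero; suc; _<_; _≤_; _∸_; z≤n; s≤s; _≤?_)
import Data.Nat.Properties as ℕ
open import Data.Fin using (Fin) renaming (zero to fzero; suc to fsuc)
import Data.Fin.Properties as Fin
open import Data.List using (List; []; _∷_; map; applyUpTo)
open import Data.Product using (∃; _×_; _,_; proj₁; proj₂)
open import Data.Empty using (⊥-elim)
open import Function using (_∘_)
open import Function.Definitions using (Injective)
open import Relation.Nullary using (¬_; yes; no)
open import Relation.Binary.Definitions using (tri<; tri≈; tri>)
open import Relation.Binary.PropositionalEquality as ≡ using (_≡_; _≢_)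
open import Algebra.Bundles using (Semiring)
import Algebra.Definitions.RawSemiring as RawSemiring

-- Restrict P to a line t ↦ a + t b with a + F b ⊆ K: the resulting univariate polynomial has
-- degree < 2q and vanishes to order 2 at all q points t, so it is zero. Argue by downward
-- induction on the degree d. For b = (x , y , 1), once all coefficients of degree > d are known
-- to vanish, the coefficient of t^d of the restriction is Σ c(i , j , d − i − j) x^i y^j, a
-- polynomial of degree < q in each of x and y that vanishes on all of F², hence is zero. So
-- all coefficients of degree d vanish too.

k<n∸m⇒m+k<n : ∀ n m k → k < n ∸ m → m ℕ.+ k < n
k<n∸m⇒m+k<n n       zero    k k<n   = k<n
k<n∸m⇒m+k<n (suc n) (suc m) k k<n∸m = s≤s (k<n∸m⇒m+k<n n m k k<n∸m)

i+j<2q : ∀ {i j q} → i < q → j < q → i ℕ.+ j < 2 ℕ.* q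
i+j<2q {q = q} i<q j<q = ℕ.+-mono-< i<q (ℕ.≤-trans j<q (ℕ.m≤m+n q 0))

downward-induction : ∀ {p} (Q : ℕ → Set p) N → Q N → (∀ {d} → d < N → Q (suc d) → Q d) → Q 0
downward-induction Q N Q[N] step = go N 0 ≡.refl
  where
  go : ∀ j d → d ℕ.+ j ≡ N → Q d
  go zero    d d+0≡N   = ≡.subst Q (≡.trans (≡.sym d+0≡N) (ℕ.+-identityʳ d)) Q[N]
  go (suc j) d d+1+j≡N = step (≡.subst (d <_) d+1+j≡N (ℕ.m<m+n d ℕ.z<s))
                              (go j (suc d) (≡.trans (≡.sym (ℕ.+-suc d j)) d+1+j≡N))

module FiniteSums {c ℓ : Level} (R : CommutativeRing c ℓ) where
  open CommutativeRing R
  open import Algebra.Properties.CommutativeSemigroup +-commutativeSemigroup using (interchange)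
  open import Relation.Binary.Reasoning.Setoid setoid

  sumTo-cong : ∀ n {f g : ℕ → Carrier} → (∀ k → k < n → f k ≈ g k) → sumTo R n f ≈ sumTo R n g
  sumTo-cong zero    f≈g = refl
  sumTo-cong (suc n) f≈g = +-cong (sumTo-cong n (λ k k<n → f≈g k (ℕ.m<n⇒m<1+n k<n))) (f≈g n ℕ.≤-refl)

  sumTo-zero : ∀ n {f : ℕ → Carrier} → (∀ k → k < n → f k ≈ 0#) → sumTo R n f ≈ 0#
  sumTo-zero n f≈0 = trans (sumTo-cong n f≈0) (sumTo-const-zero n)
    where
    sumTo-const-zero : ∀ n → sumTo R n (λ _ → 0#) ≈ 0#
    sumTo-const-zero zero    = refl
    sumTo-const-zero (suc n) = trans (+-identityʳ _) (sumTo-const-zero n)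

  sumTo-+ : ∀ n (f g : ℕ → Carrier) → sumTo R n (λ k → f k + g k) ≈ sumTo R n f + sumTo R n g
  sumTo-+ zero    f g = sym (+-identityʳ 0#)
  sumTo-+ (suc n) f g = trans (+-cong (sumTo-+ n f g) refl) (interchange _ _ _ _)

  sumTo-*ˡ : ∀ n a (f : ℕ → Carrier) → sumTo R n (λ k → a * f k) ≈ a * sumTo R n f
  sumTo-*ˡ zero    a f = sym (zeroʳ a)
  sumTo-*ˡ (suc n) a f = trans (+-cong (sumTo-*ˡ n a f) refl) (sym (distribˡ a _ _))

  sumTo-*ʳ : ∀ n a (f : ℕ → Carrier) → sumTo R n (λ k → f k * a) ≈ sumTo R n f * a
  sumTo-*ʳ n a f = begin
    sumTo R n (λ k → f k * a) ≈⟨ sumTo-cong n (λ k _ → *-comm (f k) a) ⟩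
    sumTo R n (λ k → a * f k) ≈⟨ sumTo-*ˡ n a f ⟩
    a * sumTo R n f           ≈⟨ *-comm a _ ⟩
    sumTo R n f * a           ∎

  sumTo-unfoldˡ : ∀ n (f : ℕ → Carrier) → sumTo R (suc n) f ≈ f 0 + sumTo R n (f ∘ suc)
  sumTo-unfoldˡ zero    f = trans (+-identityˡ _) (sym (+-identityʳ _))
  sumTo-unfoldˡ (suc n) f = trans (+-cong (sumTo-unfoldˡ n f) refl) (+-assoc _ _ _)

  sumTo-single : ∀ n {f : ℕ → Carrier} j → j < n → (∀ k → k < n → k ≢ j → f k ≈ 0#) →
                 sumTo R n f ≈ f j
  sumTo-single (suc n) j j<1+n others≈0 with j ℕ.≟ n
  ... | yes ≡.refl =
    trans (+-congʳ (sumTo-zero n (λ k k<n → others≈0 k (ℕ.m<n⇒m<1+n k<n) (ℕ.<⇒≢ k<n)))) (+-identityˡ _)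
  ... | no  j≢n    =
    trans (+-cong (sumTo-single n j (ℕ.≤∧≢⇒< (ℕ.≤-pred j<1+n) j≢n) (λ k k<n → others≈0 k (ℕ.m<n⇒m<1+n k<n)))
                  (others≈0 n ℕ.≤-refl (j≢n ∘ ≡.sym)))
          (+-identityʳ _)

module UnivariatePolynomials {c ℓ : Level} (R : CommutativeRing c ℓ) where
  open CommutativeRing R
  open RawSemiring (Semiring.rawSemiring semiring) using (_^_) renaming (_×_ to _·ℕ_)
  open import Algebra.Properties.CommutativeSemigroup +-commutativeSemigroup using (interchange)
  open import Algebra.Properties.Group +-group using (//-rightDividesˡ)
  open import Algebra.Solver.Ring.NaturalCoefficients.Default commutativeSemiring
    using (solve; _:=_; _:+_; _:*_; con)
  open import Algebra.Properties.Semiring.Exp semiring using (^-congˡ)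
  open import Relation.Binary.Reasoning.Setoid setoid
  open FiniteSums R

  infixl 6 _+ₚ_
  infixl 7 _*ₚ_
  infixr 7 _·ₚ_
  infixr 8 _^ₚ_

  -- Coefficient lists, constant term first.
  Poly : Set c
  Poly = List Carrier

  ev : Poly → Carrier → Carrier
  ev []      t = 0#
  ev (a ∷ p) t = a + t * ev p t

  -- The value of the formal derivative: (a + t p)′ = p + t p′.
  ev′ : Poly → Carrier → Carrier
  ev′ []      t = 0#
  ev′ (a ∷ p) t = ev p t + t * ev′ p t

  coeff : Poly → ℕ → Carrier
  coeff []      k       = 0#
  coeff (a ∷ p) zero    = a
  coeff (a ∷ p) (suc k) = coeff p k

  IsZero : Poly → Set ℓ
  IsZero p = ∀ k → coeff p k ≈ 0#

  DegreeBelow : ℕ → Poly → Set ℓ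
  DegreeBelow n p = ∀ k → n ≤ k → coeff p k ≈ 0#

  ∷-isZero : ∀ {a} p → a ≈ 0# → IsZero p → IsZero (a ∷ p)
  ∷-isZero p a≈0 p≈0 zero    = a≈0
  ∷-isZero p a≈0 p≈0 (suc k) = p≈0 k

  DegreeBelow-mono : ∀ {m n} p → m ≤ n → DegreeBelow m p → DegreeBelow n p
  DegreeBelow-mono p m≤n deg k n≤k = deg k (ℕ.≤-trans m≤n n≤k)

  DegreeBelow-tail : ∀ {n a} p → DegreeBelow (suc n) (a ∷ p) → DegreeBelow n p
  DegreeBelow-tail p deg k n≤k = deg (suc k) (s≤s n≤k)

  ev-isZero : ∀ p → IsZero p → ∀ t → ev p t ≈ 0#
  ev-isZero []      p≈0 t = refl
  ev-isZero (a ∷ p) p≈0 t = begin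
    a + t * ev p t ≈⟨ +-cong (p≈0 0) (*-congˡ (ev-isZero p (p≈0 ∘ suc) t)) ⟩
    0# + t * 0#    ≈⟨ trans (+-identityˡ _) (zeroʳ t) ⟩
    0#             ∎

  _+ₚ_ : Poly → Poly → Poly
  []      +ₚ p′       = p′
  (a ∷ p) +ₚ []       = a ∷ p
  (a ∷ p) +ₚ (b ∷ p′) = (a + b) ∷ (p +ₚ p′)

  _·ₚ_ : Carrier → Poly → Poly
  a ·ₚ p = map (a *_) p

  _*ₚ_ : Poly → Poly → Poly
  []      *ₚ p′ = []
  (a ∷ p) *ₚ p′ = a ·ₚ p′ +ₚ (0# ∷ p *ₚ p′)

  _^ₚ_ : Poly → ℕ → Poly
  p ^ₚ zero  = 1# ∷ []
  p ^ₚ suc n = p *ₚ p ^ₚ n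

  sumₚ : ℕ → (ℕ → Poly) → Poly
  sumₚ zero    f = []
  sumₚ (suc n) f = sumₚ n f +ₚ f n

  linear : Carrier → Carrier → Poly
  linear a b = a ∷ b ∷ []

  ev-+ₚ : ∀ p p′ t → ev (p +ₚ p′) t ≈ ev p t + ev p′ t
  ev-+ₚ []      p′       t = sym (+-identityˡ _)
  ev-+ₚ (a ∷ p) []       t = sym (+-identityʳ _)
  ev-+ₚ (a ∷ p) (b ∷ p′) t = begin
    (a + b) + t * ev (p +ₚ p′) t
      ≈⟨ +-congˡ (trans (*-congˡ (ev-+ₚ p p′ t)) (distribˡ t _ _)) ⟩
    (a + b) + (t * ev p t + t * ev p′ t)  ≈⟨ interchange a b _ _ ⟩
    (a + t * ev p t) + (b + t * ev p′ t)  ∎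

  ev′-+ₚ : ∀ p p′ t → ev′ (p +ₚ p′) t ≈ ev′ p t + ev′ p′ t
  ev′-+ₚ []      p′       t = sym (+-identityˡ _)
  ev′-+ₚ (a ∷ p) []       t = sym (+-identityʳ _)
  ev′-+ₚ (a ∷ p) (b ∷ p′) t = begin
    ev (p +ₚ p′) t + t * ev′ (p +ₚ p′) t
      ≈⟨ +-cong (ev-+ₚ p p′ t) (trans (*-congˡ (ev′-+ₚ p p′ t)) (distribˡ t _ _)) ⟩
    (ev p t + ev p′ t) + (t * ev′ p t + t * ev′ p′ t)
      ≈⟨ interchange _ _ _ _ ⟩
    (ev p t + t * ev′ p t) + (ev p′ t + t * ev′ p′ t) ∎

  coeff-+ₚ : ∀ p p′ k → coeff (p +ₚ p′) k ≈ coeff p k + coeff p′ k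
  coeff-+ₚ []      p′       k       = sym (+-identityˡ _)
  coeff-+ₚ (a ∷ p) []       k       = sym (+-identityʳ _)
  coeff-+ₚ (a ∷ p) (b ∷ p′) zero    = refl
  coeff-+ₚ (a ∷ p) (b ∷ p′) (suc k) = coeff-+ₚ p p′ k

  sumₚ-hom : (h : Poly → Carrier) → h [] ≈ 0# → (∀ p p′ → h (p +ₚ p′) ≈ h p + h p′) →
             ∀ n f → h (sumₚ n f) ≈ sumTo R n (h ∘ f)
  sumₚ-hom h h[]≈0 h-+ zero    f = h[]≈0
  sumₚ-hom h h[]≈0 h-+ (suc n) f = trans (h-+ (sumₚ n f) (f n)) (+-congʳ (sumₚ-hom h h[]≈0 h-+ n f))

  private
    *-pullˡ : ∀ a x t y → a * x + t * (a * y) ≈ a * (x + t * y)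
    *-pullˡ = solve 4 (λ a x t y → a :* x :+ t :* (a :* y) := a :* (x :+ t :* y)) refl

  ev-·ₚ : ∀ a p t → ev (a ·ₚ p) t ≈ a * ev p t
  ev-·ₚ a []      t = sym (zeroʳ a)
  ev-·ₚ a (b ∷ p) t = trans (+-congˡ (*-congˡ (ev-·ₚ a p t))) (*-pullˡ a b t _)

  ev′-·ₚ : ∀ a p t → ev′ (a ·ₚ p) t ≈ a * ev′ p t
  ev′-·ₚ a []      t = sym (zeroʳ a)
  ev′-·ₚ a (b ∷ p) t = trans (+-cong (ev-·ₚ a p t) (*-congˡ (ev′-·ₚ a p t))) (*-pullˡ a _ t _)

  coeff-·ₚ : ∀ a p k → coeff (a ·ₚ p) k ≈ a * coeff p k
  coeff-·ₚ a []      k       = sym (zeroʳ a)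
  coeff-·ₚ a (b ∷ p) zero    = refl
  coeff-·ₚ a (b ∷ p) (suc k) = coeff-·ₚ a p k

  ev-*ₚ : ∀ p p′ t → ev (p *ₚ p′) t ≈ ev p t * ev p′ t
  ev-*ₚ []      p′ t = sym (zeroˡ _)
  ev-*ₚ (a ∷ p) p′ t = begin
    ev (a ·ₚ p′ +ₚ (0# ∷ p *ₚ p′)) t           ≈⟨ ev-+ₚ (a ·ₚ p′) _ t ⟩
    ev (a ·ₚ p′) t + (0# + t * ev (p *ₚ p′) t)
      ≈⟨ +-cong (ev-·ₚ a p′ t) (trans (+-identityˡ _) (*-congˡ (ev-*ₚ p p′ t))) ⟩
    a * ev p′ t + t * (ev p t * ev p′ t)       ≈⟨ +-congˡ (*-assoc t _ _) ⟨
    a * ev p′ t + t * ev p t * ev p′ t         ≈⟨ distribʳ (ev p′ t) a _ ⟨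
    (a + t * ev p t) * ev p′ t                 ∎

  ev′-*ₚ : ∀ p p′ t → ev′ (p *ₚ p′) t ≈ ev′ p t * ev p′ t + ev p t * ev′ p′ t
  ev′-*ₚ []      p′ t = sym (trans (+-cong (zeroˡ _) (zeroˡ _)) (+-identityʳ 0#))
  ev′-*ₚ (a ∷ p) p′ t = begin
    ev′ (a ·ₚ p′ +ₚ (0# ∷ p *ₚ p′)) t                      ≈⟨ ev′-+ₚ (a ·ₚ p′) _ t ⟩
    ev′ (a ·ₚ p′) t + (ev (p *ₚ p′) t + t * ev′ (p *ₚ p′) t)
      ≈⟨ +-cong (ev′-·ₚ a p′ t) (+-cong (ev-*ₚ p p′ t) (*-congˡ (ev′-*ₚ p p′ t))) ⟩
    a * D′ + (E * E′ + t * (D * E′ + E * D′))              ≈⟨ product-rule a t E E′ D D′ ⟩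
    (E + t * D) * E′ + (a + t * E) * D′                    ∎
    where
    E = ev p t ; E′ = ev p′ t ; D = ev′ p t ; D′ = ev′ p′ t
    product-rule : ∀ a t E E′ D D′ →
      a * D′ + (E * E′ + t * (D * E′ + E * D′)) ≈ (E + t * D) * E′ + (a + t * E) * D′
    product-rule = solve 6 (λ a t E E′ D D′ →
      a :* D′ :+ (E :* E′ :+ t :* (D :* E′ :+ E :* D′))
      := (E :+ t :* D) :* E′ :+ (a :+ t :* E) :* D′) refl

  coeff-∷-*ₚ : ∀ a p p′ k →
               coeff ((a ∷ p) *ₚ p′) k ≈ a * coeff p′ k + coeff (0# ∷ p *ₚ p′) k
  coeff-∷-*ₚ a p p′ k = trans (coeff-+ₚ (a ·ₚ p′) _ k) (+-congʳ (coeff-·ₚ a p′ k))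

  *ₚ-zeroˡ : ∀ p p′ → IsZero p → IsZero (p *ₚ p′)
  *ₚ-zeroˡ []      p′ p≈0 k = refl
  *ₚ-zeroˡ (a ∷ p) p′ p≈0 k = begin
    coeff ((a ∷ p) *ₚ p′) k                 ≈⟨ coeff-∷-*ₚ a p p′ k ⟩
    a * coeff p′ k + coeff (0# ∷ p *ₚ p′) k
      ≈⟨ +-cong (trans (*-congʳ (p≈0 0)) (zeroˡ _)) (∷-isZero (p *ₚ p′) refl (*ₚ-zeroˡ p p′ (p≈0 ∘ suc)) k) ⟩
    0# + 0#                                 ≈⟨ +-identityʳ 0# ⟩
    0#                                      ∎

  *ₚ-degree : ∀ m n p p′ → DegreeBelow m p → DegreeBelow (suc n) p′ →
              DegreeBelow (m ℕ.+ n) (p *ₚ p′)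
  *ₚ-degree m       n []      p′ _   _    k _ = refl
  *ₚ-degree zero    n (a ∷ p) p′ deg _    k _ = *ₚ-zeroˡ (a ∷ p) p′ (λ k → deg k z≤n) k
  *ₚ-degree (suc m) n (a ∷ p) p′ deg deg′ k m+n<k = begin
    coeff ((a ∷ p) *ₚ p′) k                 ≈⟨ coeff-∷-*ₚ a p p′ k ⟩
    a * coeff p′ k + coeff (0# ∷ p *ₚ p′) k
      ≈⟨ +-cong (trans (*-congˡ (deg′ k n<k)) (zeroʳ a)) (shifted k m+n<k) ⟩
    0# + 0#                                 ≈⟨ +-identityʳ 0# ⟩
    0#                                      ∎
    where
    n<k : suc n ≤ k
    n<k = ℕ.≤-trans (s≤s (ℕ.m≤n+m n m)) m+n<k
    shifted : DegreeBelow (suc (m ℕ.+ n)) (0# ∷ p *ₚ p′)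
    shifted (suc k) (s≤s m+n≤k) = *ₚ-degree m n p p′ (DegreeBelow-tail p deg) deg′ k m+n≤k

  coeff-*ₚ-top : ∀ m n p p′ → DegreeBelow (suc m) p → DegreeBelow (suc n) p′ →
                 coeff (p *ₚ p′) (m ℕ.+ n) ≈ coeff p m * coeff p′ n
  coeff-*ₚ-top m       n []      p′ _   _    = sym (zeroˡ _)
  coeff-*ₚ-top zero    n (a ∷ p) p′ deg deg′ = begin
    coeff ((a ∷ p) *ₚ p′) n                 ≈⟨ coeff-∷-*ₚ a p p′ n ⟩
    a * coeff p′ n + coeff (0# ∷ p *ₚ p′) n
      ≈⟨ +-congˡ (∷-isZero (p *ₚ p′) refl (*ₚ-zeroˡ p p′ (λ k → DegreeBelow-tail p deg k z≤n)) n) ⟩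
    a * coeff p′ n + 0#                     ≈⟨ +-identityʳ _ ⟩
    a * coeff p′ n                          ∎
  coeff-*ₚ-top (suc m) n (a ∷ p) p′ deg deg′ = begin
    coeff ((a ∷ p) *ₚ p′) (suc (m ℕ.+ n))               ≈⟨ coeff-∷-*ₚ a p p′ _ ⟩
    a * coeff p′ (suc (m ℕ.+ n)) + coeff (p *ₚ p′) (m ℕ.+ n)
      ≈⟨ +-cong (trans (*-congˡ (deg′ _ (s≤s (ℕ.m≤n+m n m)))) (zeroʳ a))
                (coeff-*ₚ-top m n p p′ (DegreeBelow-tail p deg) deg′) ⟩
    0# + coeff p m * coeff p′ n                         ≈⟨ +-identityˡ _ ⟩
    coeff p m * coeff p′ n                              ∎

  ev-^ₚ : ∀ p n t → ev (p ^ₚ n) t ≈ ev p t ^ n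
  ev-^ₚ p zero    t = trans (+-congˡ (zeroʳ t)) (+-identityʳ 1#)
  ev-^ₚ p (suc n) t = trans (ev-*ₚ p (p ^ₚ n) t) (*-congˡ (ev-^ₚ p n t))

  ev′-^ₚ : ∀ p n t → ev′ (p ^ₚ n) t ≈ (n ·ℕ 1#) * (ev p t ^ (n ∸ 1) * ev′ p t)
  ev′-^ₚ p zero          t = trans (+-identityˡ _) (trans (zeroʳ t) (sym (zeroˡ _)))
  ev′-^ₚ p (suc zero)    t = begin
    ev′ (p *ₚ p ^ₚ 0) t                                  ≈⟨ ev′-*ₚ p (p ^ₚ 0) t ⟩
    D * ev (p ^ₚ 0) t + E * ev′ (p ^ₚ 0) t
      ≈⟨ +-cong (*-congˡ (ev-^ₚ p 0 t)) (*-congˡ (ev′-^ₚ p 0 t)) ⟩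
    D * 1# + E * (0# * (1# * D))                         ≈⟨ power-rule D E ⟩
    (1# + 0#) * (1# * D)                                 ∎
    where
    E = ev p t ; D = ev′ p t
    power-rule : ∀ D E → D * 1# + E * (0# * (1# * D)) ≈ (1# + 0#) * (1# * D)
    power-rule = solve 2 (λ D E →
      D :* con 1 :+ E :* (con 0 :* (con 1 :* D)) := (con 1 :+ con 0) :* (con 1 :* D)) refl
  ev′-^ₚ p (suc (suc n)) t = begin
    ev′ (p *ₚ p ^ₚ suc n) t                              ≈⟨ ev′-*ₚ p (p ^ₚ suc n) t ⟩
    D * ev (p ^ₚ suc n) t + E * ev′ (p ^ₚ suc n) t
      ≈⟨ +-cong (*-congˡ (ev-^ₚ p (suc n) t)) (*-congˡ (ev′-^ₚ p (suc n) t)) ⟩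
    D * (E * E ^ n) + E * (N * (E ^ n * D))              ≈⟨ power-rule D E (E ^ n) N ⟩
    (1# + N) * ((E * E ^ n) * D)                         ∎
    where
    E = ev p t ; D = ev′ p t ; N = suc n ·ℕ 1#
    power-rule : ∀ D E Eⁿ N → D * (E * Eⁿ) + E * (N * (Eⁿ * D)) ≈ (1# + N) * ((E * Eⁿ) * D)
    power-rule = solve 4 (λ D E Eⁿ N →
      D :* (E :* Eⁿ) :+ E :* (N :* (Eⁿ :* D)) := (con 1 :+ N) :* ((E :* Eⁿ) :* D)) refl

  ev-linear : ∀ a b t → ev (linear a b) t ≈ a + t * b
  ev-linear a b t = +-congˡ (*-congˡ (trans (+-congˡ (zeroʳ t)) (+-identityʳ b)))

  ev′-linear : ∀ a b t → ev′ (linear a b) t ≈ b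
  ev′-linear a b t = begin
    (b + t * 0#) + t * (0# + t * 0#)
      ≈⟨ +-cong (+-congˡ (zeroʳ t)) (*-congˡ (trans (+-identityˡ _) (zeroʳ t))) ⟩
    (b + 0#) + t * 0#                ≈⟨ trans (+-cong (+-identityʳ b) (zeroʳ t)) (+-identityʳ b) ⟩
    b                                ∎

  linear-degree : ∀ a b → DegreeBelow 2 (linear a b)
  linear-degree a b (suc zero)    (s≤s ())
  linear-degree a b (suc (suc k)) _ = refl

  linear-^ₚ-degree : ∀ a b n → DegreeBelow (suc n) (linear a b ^ₚ n)
  linear-^ₚ-degree a b zero    (suc k) _ = refl
  linear-^ₚ-degree a b (suc n) =
    *ₚ-degree 2 n (linear a b) (linear a b ^ₚ n) (linear-degree a b) (linear-^ₚ-degree a b n)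

  coeff-linear-^ₚ-top : ∀ a b n → coeff (linear a b ^ₚ n) n ≈ b ^ n
  coeff-linear-^ₚ-top a b zero    = refl
  coeff-linear-^ₚ-top a b (suc n) =
    trans (coeff-*ₚ-top 1 n (linear a b) (linear a b ^ₚ n) (linear-degree a b) (linear-^ₚ-degree a b n))
          (*-congˡ (coeff-linear-^ₚ-top a b n))

  ev-linear-^ₚ : ∀ a b n t → ev (linear a b ^ₚ n) t ≈ (a + t * b) ^ n
  ev-linear-^ₚ a b n t = trans (ev-^ₚ (linear a b) n t) (^-congˡ n (ev-linear a b t))

  ev′-linear-^ₚ : ∀ a b n t → ev′ (linear a b ^ₚ n) t ≈ (n ·ℕ 1#) * ((a + t * b) ^ (n ∸ 1) * b)
  ev′-linear-^ₚ a b n t =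
    trans (ev′-^ₚ (linear a b) n t)
          (*-congˡ (*-cong (^-congˡ (n ∸ 1) (ev-linear a b t)) (ev′-linear a b t)))

  ev-applyUpTo : ∀ n f t → ev (applyUpTo f n) t ≈ sumTo R n (λ k → f k * t ^ k)
  ev-applyUpTo zero    f t = refl
  ev-applyUpTo (suc n) f t = sym (begin
    sumTo R (suc n) (λ k → f k * t ^ k)
      ≈⟨ sumTo-unfoldˡ n _ ⟩
    f 0 * 1# + sumTo R n (λ k → f (suc k) * (t * t ^ k))
      ≈⟨ +-cong (*-identityʳ _) (sumTo-cong n (λ k _ → x∙yz≈y∙xz (f (suc k)) t _)) ⟩
    f 0 + sumTo R n (λ k → t * (f (suc k) * t ^ k))
      ≈⟨ +-congˡ (sumTo-*ˡ n t _) ⟩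
    f 0 + t * sumTo R n (λ k → f (suc k) * t ^ k)
      ≈⟨ +-congˡ (*-congˡ (ev-applyUpTo n (f ∘ suc) t)) ⟨
    f 0 + t * ev (applyUpTo (f ∘ suc) n) t
      ∎)
    where open import Algebra.Properties.CommutativeSemigroup *-commutativeSemigroup using (x∙yz≈y∙xz)

  coeff-applyUpTo : ∀ n f k → k < n → coeff (applyUpTo f n) k ≡ f k
  coeff-applyUpTo (suc n) f zero    _         = ≡.refl
  coeff-applyUpTo (suc n) f (suc k) (s≤s k<n) = coeff-applyUpTo n (f ∘ suc) k k<n

  applyUpTo-degree : ∀ n f → DegreeBelow n (applyUpTo f n)
  applyUpTo-degree zero    f k       _         = refl
  applyUpTo-degree (suc n) f (suc k) (s≤s n≤k) = applyUpTo-degree n (f ∘ suc) k n≤k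

  -- Synthetic division by x − r; the remainder is ev p r.
  quotient : Carrier → Poly → Poly
  quotient r []      = []
  quotient r (a ∷ p) = ev p r ∷ quotient r p

  ev-quotient : ∀ r p t → ev p t ≈ (t - r) * ev (quotient r p) t + ev p r
  ev-quotient r []      t = sym (trans (+-identityʳ _) (zeroʳ _))
  ev-quotient r (a ∷ p) t = begin
    a + t * ev p t                      ≈⟨ +-congˡ (*-cong t≈u+r (ev-quotient r p t)) ⟩
    a + (u + r) * (u * E + C)           ≈⟨ regroup a u r E C ⟩
    u * (C + (u + r) * E) + (a + r * C) ≈⟨ +-congʳ (*-congˡ (+-congˡ (*-congʳ t≈u+r))) ⟨
    u * (C + t * E) + (a + r * C)       ∎
    where
    u = t - r ; C = ev p r ; E = ev (quotient r p) t
    t≈u+r : t ≈ u + r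
    t≈u+r = sym (//-rightDividesˡ r t)
    regroup : ∀ a u r E C → a + (u + r) * (u * E + C) ≈ u * (C + (u + r) * E) + (a + r * C)
    regroup = solve 5 (λ a u r E C →
      a :+ (u :+ r) :* (u :* E :+ C) := u :* (C :+ (u :+ r) :* E) :+ (a :+ r :* C)) refl

  ev′≈ev-quotient : ∀ r p → ev′ p r ≈ ev (quotient r p) r
  ev′≈ev-quotient r []      = refl
  ev′≈ev-quotient r (a ∷ p) = +-congˡ (*-congˡ (ev′≈ev-quotient r p))

  ev′-quotient : ∀ r p t → ev′ p t ≈ ev (quotient r p) t + (t - r) * ev′ (quotient r p) t
  ev′-quotient r []      t = sym (trans (+-identityˡ _) (zeroʳ _))
  ev′-quotient r (a ∷ p) t = begin
    ev p t + t * ev′ p t            ≈⟨ +-cong (ev-quotient r p t) (*-congˡ (ev′-quotient r p t)) ⟩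
    (u * E + C) + t * (E + u * D)   ≈⟨ regroup u t E C D ⟩
    (C + t * E) + u * (E + t * D)   ∎
    where
    u = t - r ; C = ev p r ; E = ev (quotient r p) t ; D = ev′ (quotient r p) t
    regroup : ∀ u t E C D → (u * E + C) + t * (E + u * D) ≈ (C + t * E) + u * (E + t * D)
    regroup = solve 5 (λ u t E C D →
      (u :* E :+ C) :+ t :* (E :+ u :* D) := (C :+ t :* E) :+ u :* (E :+ t :* D)) refl

  quotient-degree : ∀ {n} r p → DegreeBelow (suc n) p → DegreeBelow n (quotient r p)
  quotient-degree r []      deg k       _     = refl
  quotient-degree r (a ∷ p) deg zero    z≤n   = ev-isZero p (λ k → deg (suc k) (s≤s z≤n)) r
  quotient-degree r (a ∷ p) deg (suc k) n≤1+k =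
    quotient-degree r p (DegreeBelow-mono p n≤1+k (DegreeBelow-tail p deg)) k ℕ.≤-refl

  quotient-isZero : ∀ r p → IsZero (quotient r p) → ev p r ≈ 0# → IsZero p
  quotient-isZero r []      _    _     = λ _ → refl
  quotient-isZero r (a ∷ p) q≈0 p[r]≈0 = ∷-isZero p a≈0 (quotient-isZero r p (q≈0 ∘ suc) (q≈0 0))
    where
    a≈0 : a ≈ 0#
    a≈0 = begin
      a              ≈⟨ +-identityʳ a ⟨
      a + 0#         ≈⟨ +-congˡ (trans (*-congˡ (q≈0 0)) (zeroʳ r)) ⟨
      a + r * ev p r ≈⟨ p[r]≈0 ⟩
      0#             ∎

module RootCounting {c ℓ : Level} (F : CommutativeRing c ℓ) (isField : IsField F) where
  open CommutativeRing F
  open RawSemiring (Semiring.rawSemiring semiring) using (_^_)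
  open import Algebra.Properties.Group +-group using (x∙y⁻¹≈ε⇒x≈y)
  open import Algebra.Properties.CommutativeSemigroup *-commutativeSemigroup using (xy∙z≈y∙xz; xy∙z≈x∙zy)
  open import Relation.Binary.Reasoning.Setoid setoid
  open FiniteSums F
  open UnivariatePolynomials F

  x*y≈0⇒y≈0 : ∀ {x y} → ¬ x ≈ 0# → x * y ≈ 0# → y ≈ 0#
  x*y≈0⇒y≈0 {x} {y} x≉0 xy≈0 with proj₂ isField x x≉0
  ... | x⁻¹ , xx⁻¹≈1 = begin
    y             ≈⟨ *-identityˡ y ⟨
    1# * y        ≈⟨ *-congʳ xx⁻¹≈1 ⟨
    x * x⁻¹ * y   ≈⟨ xy∙z≈y∙xz x x⁻¹ y ⟩
    x⁻¹ * (x * y) ≈⟨ *-congˡ xy≈0 ⟩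
    x⁻¹ * 0#      ≈⟨ zeroʳ x⁻¹ ⟩
    0#            ∎

  private
    cancel-difference : ∀ {r s x y z} → ¬ s ≈ r → x ≈ (s - r) * y + z → x ≈ 0# → z ≈ 0# → y ≈ 0#
    cancel-difference {r} {s} {x} {y} {z} s≉r x≈ x≈0 z≈0 =
      x*y≈0⇒y≈0 (s≉r ∘ x∙y⁻¹≈ε⇒x≈y s r) (begin
      (s - r) * y      ≈⟨ +-identityʳ _ ⟨
      (s - r) * y + 0# ≈⟨ +-congˡ z≈0 ⟨
      (s - r) * y + z  ≈⟨ x≈ ⟨
      x                ≈⟨ x≈0 ⟩
      0#               ∎)

  quotient-root : ∀ {r s} p → ¬ s ≈ r → ev p s ≈ 0# → ev p r ≈ 0# → ev (quotient r p) s ≈ 0#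
  quotient-root {r} {s} p s≉r = cancel-difference s≉r (ev-quotient r p s)

  quotient-root′ : ∀ {r s} p → ¬ s ≈ r → ev′ p s ≈ 0# → ev (quotient r p) s ≈ 0# →
                   ev′ (quotient r p) s ≈ 0#
  quotient-root′ {r} {s} p s≉r = cancel-difference s≉r (trans (ev′-quotient r p s) (+-comm _ _))

  roots⇒isZero : ∀ m (e : Fin m → Carrier) → Injective _≡_ _≈_ e → ∀ p → DegreeBelow m p →
                 (∀ i → ev p (e i) ≈ 0#) → IsZero p
  roots⇒isZero zero    e e-inj p deg p[e]≈0 k = deg k z≤n
  roots⇒isZero (suc m) e e-inj p deg p[e]≈0 = quotient-isZero r p
    (roots⇒isZero m (e ∘ fsuc) (Fin.suc-injective ∘ e-inj) (quotient r p) (quotient-degree r p deg)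
      (λ i → quotient-root p (distinct i) (p[e]≈0 (fsuc i)) (p[e]≈0 fzero)))
    (p[e]≈0 fzero)
    where
    r = e fzero
    distinct : ∀ i → ¬ e (fsuc i) ≈ r
    distinct i = Fin.0≢1+n ∘ ≡.sym ∘ e-inj

  doubleRoots⇒isZero : ∀ m (e : Fin m → Carrier) → Injective _≡_ _≈_ e → ∀ p →
                       DegreeBelow (m ℕ.+ m) p → (∀ i → ev p (e i) ≈ 0#) → (∀ i → ev′ p (e i) ≈ 0#) →
                       IsZero p
  doubleRoots⇒isZero zero    e e-inj p deg p[e]≈0 p′[e]≈0 k = deg k z≤n
  doubleRoots⇒isZero (suc m) e e-inj p deg p[e]≈0 p′[e]≈0 =
    quotient-isZero r p (quotient-isZero r p₁ p₂≈0 p₁[r]≈0) (p[e]≈0 fzero)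
    where
    r = e fzero
    p₁ = quotient r p
    p₂ = quotient r p₁
    distinct : ∀ i → ¬ e (fsuc i) ≈ r
    distinct i = Fin.0≢1+n ∘ ≡.sym ∘ e-inj
    p₁[r]≈0 : ev p₁ r ≈ 0#
    p₁[r]≈0 = trans (sym (ev′≈ev-quotient r p)) (p′[e]≈0 fzero)
    p₁-degree : DegreeBelow (suc (m ℕ.+ m)) p₁
    p₁-degree = ≡.subst (λ n → DegreeBelow n p₁) (ℕ.+-suc m m) (quotient-degree r p deg)
    p₁[e]≈0 : ∀ i → ev p₁ (e (fsuc i)) ≈ 0#
    p₁[e]≈0 i = quotient-root p (distinct i) (p[e]≈0 (fsuc i)) (p[e]≈0 fzero)
    p₁′[e]≈0 : ∀ i → ev′ p₁ (e (fsuc i)) ≈ 0#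
    p₁′[e]≈0 i = quotient-root′ p (distinct i) (p′[e]≈0 (fsuc i)) (p₁[e]≈0 i)
    p₂[e]≈0 : ∀ i → ev p₂ (e (fsuc i)) ≈ 0#
    p₂[e]≈0 i = quotient-root p₁ (distinct i) (p₁[e]≈0 i) p₁[r]≈0
    p₂≈0 : IsZero p₂
    p₂≈0 = doubleRoots⇒isZero m (e ∘ fsuc) (Fin.suc-injective ∘ e-inj) p₂ (quotient-degree r p₁ p₁-degree)
      p₂[e]≈0 (λ i → quotient-root′ p₁ (distinct i) (p₁′[e]≈0 i) (p₂[e]≈0 i))

  roots⇒coeff≈0 : ∀ m (e : Fin m → Carrier) → Injective _≡_ _≈_ e → ∀ f →
                  (∀ i → sumTo F m (λ k → f k * e i ^ k) ≈ 0#) → ∀ k → k < m → f k ≈ 0#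
  roots⇒coeff≈0 m e e-inj f f[e]≈0 k k<m = ≡.subst (_≈ 0#) (coeff-applyUpTo m f k k<m)
    (roots⇒isZero m e e-inj (applyUpTo f m) (applyUpTo-degree m f)
      (λ i → trans (ev-applyUpTo m f (e i)) (f[e]≈0 i)) k)

  bivariate-roots⇒coeff≈0 : ∀ m (e : Fin m → Carrier) → Injective _≡_ _≈_ e → (C : ℕ → ℕ → Carrier) →
                            (∀ x y → sumTo F m (λ i → sumTo F m (λ j → C i j * (x ^ i * y ^ j))) ≈ 0#) →
                            ∀ i j → i < m → j < m → C i j ≈ 0#
  bivariate-roots⇒coeff≈0 m e e-inj C C[x,y]≈0 i j i<m j<m =
    roots⇒coeff≈0 m e e-inj (C i) (λ y → rows≈0 (e y) i i<m) j j<m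
    where
    row : Carrier → ℕ → Carrier
    row y i = sumTo F m (λ j → C i j * y ^ j)
    regroup : ∀ x y i → row y i * x ^ i ≈ sumTo F m (λ j → C i j * (x ^ i * y ^ j))
    regroup x y i = trans (sym (sumTo-*ʳ m _ _)) (sumTo-cong m (λ j _ → xy∙z≈x∙zy (C i j) _ _))
    rows≈0 : ∀ y i → i < m → row y i ≈ 0#
    rows≈0 y = roots⇒coeff≈0 m e e-inj (row y)
      (λ x → trans (sumTo-cong m (λ i _ → regroup (e x) y i)) (C[x,y]≈0 (e x) y))

module LineRestriction {c ℓ : Level} (R : CommutativeRing c ℓ) (q : ℕ) (P : Coeffs R) where
  open CommutativeRing R
  open RawSemiring (Semiring.rawSemiring semiring) using (_^_) renaming (_×_ to _·ℕ_)
  open import Algebra.Solver.Ring.NaturalCoefficients.Default commutativeSemiring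
    using (solve; _:=_; _:+_; _:*_)
  open import Relation.Binary.Reasoning.Setoid setoid
  open FiniteSums R
  open UnivariatePolynomials R

  degree : Exps R → ℕ
  degree (i , j , k) = i ℕ.+ j ℕ.+ k

  range₃ : ℕ → ℕ → ℕ
  range₃ i j = 2 ℕ.* q ∸ (i ℕ.+ j)

  inA : ∀ {i j k} → i < q → j < q → k < range₃ i j → InA R q (i , j , k)
  inA {i} {j} {k} i<q j<q k< = k<n∸m⇒m+k<n _ (i ℕ.+ j) k k< , i<q , j<q

  sumA-cong : ∀ {f g : Exps R → Carrier} → (∀ α → InA R q α → f α ≈ g α) →
              sumA R q f ≈ sumA R q g
  sumA-cong f≈g = sumTo-cong q λ i i<q → sumTo-cong q λ j j<q → sumTo-cong (range₃ i j) λ k k< →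
    f≈g (i , j , k) (inA i<q j<q k<)

  sumA-zero : ∀ {f : Exps R → Carrier} → (∀ α → InA R q α → f α ≈ 0#) → sumA R q f ≈ 0#
  sumA-zero f≈0 =
    trans (sumA-cong f≈0) (sumTo-zero q λ i _ → sumTo-zero q λ j _ → sumTo-zero (range₃ i j) λ _ _ → refl)

  sumA-+ : ∀ (f g : Exps R → Carrier) → sumA R q (λ α → f α + g α) ≈ sumA R q f + sumA R q g
  sumA-+ f g =
    trans (sumTo-cong q λ i _ → trans (sumTo-cong q λ j _ → sumTo-+ (range₃ i j) _ _) (sumTo-+ q _ _))
          (sumTo-+ q _ _)

  sumA-*ˡ : ∀ a (f : Exps R → Carrier) → sumA R q (λ α → a * f α) ≈ a * sumA R q f
  sumA-*ˡ a f =
    trans (sumTo-cong q λ i _ → trans (sumTo-cong q λ j _ → sumTo-*ˡ (range₃ i j) a _) (sumTo-*ˡ q a _))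
          (sumTo-*ˡ q a _)

  sumAₚ : (Exps R → Poly) → Poly
  sumAₚ g = sumₚ q λ i → sumₚ q λ j → sumₚ (range₃ i j) λ k → g (i , j , k)

  sumAₚ-hom : (h : Poly → Carrier) → h [] ≈ 0# → (∀ p p′ → h (p +ₚ p′) ≈ h p + h p′) →
              ∀ g → h (sumAₚ g) ≈ sumA R q (h ∘ g)
  sumAₚ-hom h h[]≈0 h-+ g =
    trans (hom q _) (sumTo-cong q λ i _ → trans (hom q _) (sumTo-cong q λ j _ → hom (range₃ i j) _))
    where hom = sumₚ-hom h h[]≈0 h-+

  monomial : Exps R → Point R → Carrier
  monomial (i , j , k) (x₁ , x₂ , x₃) = x₁ ^ i * x₂ ^ j * x₃ ^ k

  ∂₁monomial ∂₂monomial ∂₃monomial : Exps R → Point R → Carrier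
  ∂₁monomial (i , j , k) (x₁ , x₂ , x₃) = (i ·ℕ 1#) * (x₁ ^ (i ∸ 1) * x₂ ^ j * x₃ ^ k)
  ∂₂monomial (i , j , k) (x₁ , x₂ , x₃) = (j ·ℕ 1#) * (x₁ ^ i * x₂ ^ (j ∸ 1) * x₃ ^ k)
  ∂₃monomial (i , j , k) (x₁ , x₂ , x₃) = (k ·ℕ 1#) * (x₁ ^ i * x₂ ^ j * x₃ ^ (k ∸ 1))

  monomialOnLine : Point R → Point R → Exps R → Poly
  monomialOnLine (a₁ , a₂ , a₃) (b₁ , b₂ , b₃) (i , j , k) =
    linear a₁ b₁ ^ₚ i *ₚ linear a₂ b₂ ^ₚ j *ₚ linear a₃ b₃ ^ₚ k

  restrictToLine : Point R → Point R → Poly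
  restrictToLine a b = sumAₚ (λ α → P α ·ₚ monomialOnLine a b α)

  ev-monomialOnLine : ∀ a b α t → ev (monomialOnLine a b α) t ≈ monomial α (line R a b t)
  ev-monomialOnLine (a₁ , a₂ , a₃) (b₁ , b₂ , b₃) (i , j , k) t = begin
    ev (A *ₚ B *ₚ C) t          ≈⟨ ev-*ₚ (A *ₚ B) C t ⟩
    ev (A *ₚ B) t * ev C t      ≈⟨ *-congʳ (ev-*ₚ A B t) ⟩
    ev A t * ev B t * ev C t
      ≈⟨ *-cong (*-cong (ev-linear-^ₚ a₁ b₁ i t) (ev-linear-^ₚ a₂ b₂ j t)) (ev-linear-^ₚ a₃ b₃ k t) ⟩
    (a₁ + t * b₁) ^ i * (a₂ + t * b₂) ^ j * (a₃ + t * b₃) ^ k ∎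
    where
    A = linear a₁ b₁ ^ₚ i ; B = linear a₂ b₂ ^ₚ j ; C = linear a₃ b₃ ^ₚ k

  ev′-monomialOnLine : ∀ a b₁ b₂ b₃ α t → let x = line R a (b₁ , b₂ , b₃) t in
    ev′ (monomialOnLine a (b₁ , b₂ , b₃) α) t
      ≈ b₁ * ∂₁monomial α x + b₂ * ∂₂monomial α x + b₃ * ∂₃monomial α x
  ev′-monomialOnLine (a₁ , a₂ , a₃) b₁ b₂ b₃ (i , j , k) t = begin
    ev′ (A *ₚ B *ₚ C) t
      ≈⟨ ev′-*ₚ (A *ₚ B) C t ⟩
    ev′ (A *ₚ B) t * ev C t + ev (A *ₚ B) t * ev′ C t
      ≈⟨ +-cong (*-congʳ (ev′-*ₚ A B t)) (*-congʳ (ev-*ₚ A B t)) ⟩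
    (ev′ A t * ev B t + ev A t * ev′ B t) * ev C t + ev A t * ev B t * ev′ C t
      ≈⟨ +-cong (*-cong (+-cong (*-cong (ev′-linear-^ₚ a₁ b₁ i t) (ev-linear-^ₚ a₂ b₂ j t))
                                (*-cong (ev-linear-^ₚ a₁ b₁ i t) (ev′-linear-^ₚ a₂ b₂ j t)))
                        (ev-linear-^ₚ a₃ b₃ k t))
                (*-cong (*-cong (ev-linear-^ₚ a₁ b₁ i t) (ev-linear-^ₚ a₂ b₂ j t)) (ev′-linear-^ₚ a₃ b₃ k t)) ⟩
    _ ≈⟨ chain-rule (i ·ℕ 1#) (j ·ℕ 1#) (k ·ℕ 1#) _ _ _ _ _ _ b₁ b₂ b₃ ⟩
    _ ∎
    where
    A = linear a₁ b₁ ^ₚ i ; B = linear a₂ b₂ ^ₚ j ; C = linear a₃ b₃ ^ₚ k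
    chain-rule : ∀ N₁ N₂ N₃ d₁ d₂ d₃ e₁ e₂ e₃ b₁ b₂ b₃ →
      (N₁ * (d₁ * b₁) * e₂ + e₁ * (N₂ * (d₂ * b₂))) * e₃ + e₁ * e₂ * (N₃ * (d₃ * b₃))
      ≈ b₁ * (N₁ * (d₁ * e₂ * e₃)) + b₂ * (N₂ * (e₁ * d₂ * e₃)) + b₃ * (N₃ * (e₁ * e₂ * d₃))
    chain-rule = solve 12 (λ N₁ N₂ N₃ d₁ d₂ d₃ e₁ e₂ e₃ b₁ b₂ b₃ →
      (N₁ :* (d₁ :* b₁) :* e₂ :+ e₁ :* (N₂ :* (d₂ :* b₂))) :* e₃ :+ e₁ :* e₂ :* (N₃ :* (d₃ :* b₃))
      := b₁ :* (N₁ :* (d₁ :* e₂ :* e₃)) :+ b₂ :* (N₂ :* (e₁ :* d₂ :* e₃)) :+ b₃ :* (N₃ :* (e₁ :* e₂ :* d₃))) refl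

  monomialOnLine-degree : ∀ a b α → DegreeBelow (suc (degree α)) (monomialOnLine a b α)
  monomialOnLine-degree (a₁ , a₂ , a₃) (b₁ , b₂ , b₃) (i , j , k) =
    *ₚ-degree (suc (i ℕ.+ j)) k (A *ₚ B) C
      (*ₚ-degree (suc i) j A B (linear-^ₚ-degree a₁ b₁ i) (linear-^ₚ-degree a₂ b₂ j))
      (linear-^ₚ-degree a₃ b₃ k)
    where
    A = linear a₁ b₁ ^ₚ i ; B = linear a₂ b₂ ^ₚ j ; C = linear a₃ b₃ ^ₚ k

  coeff-monomialOnLine-top : ∀ a b α → coeff (monomialOnLine a b α) (degree α) ≈ monomial α b
  coeff-monomialOnLine-top (a₁ , a₂ , a₃) (b₁ , b₂ , b₃) (i , j , k) = begin
    coeff (A *ₚ B *ₚ C) (i ℕ.+ j ℕ.+ k)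
      ≈⟨ coeff-*ₚ-top (i ℕ.+ j) k (A *ₚ B) C (*ₚ-degree (suc i) j A B A-degree B-degree) C-degree ⟩
    coeff (A *ₚ B) (i ℕ.+ j) * coeff C k
      ≈⟨ *-congʳ (coeff-*ₚ-top i j A B A-degree B-degree) ⟩
    coeff A i * coeff B j * coeff C k
      ≈⟨ *-cong (*-cong (coeff-linear-^ₚ-top a₁ b₁ i) (coeff-linear-^ₚ-top a₂ b₂ j)) (coeff-linear-^ₚ-top a₃ b₃ k) ⟩
    b₁ ^ i * b₂ ^ j * b₃ ^ k
      ∎
    where
    A = linear a₁ b₁ ^ₚ i ; B = linear a₂ b₂ ^ₚ j ; C = linear a₃ b₃ ^ₚ k
    A-degree = linear-^ₚ-degree a₁ b₁ i
    B-degree = linear-^ₚ-degree a₂ b₂ j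
    C-degree = linear-^ₚ-degree a₃ b₃ k

  ev-restrictToLine : ∀ a b t → ev (restrictToLine a b) t ≈ eval R q P (line R a b t)
  ev-restrictToLine a b t =
    trans (sumAₚ-hom (λ p → ev p t) refl (λ p p′ → ev-+ₚ p p′ t) _)
          (sumA-cong λ α _ → trans (ev-·ₚ (P α) (monomialOnLine a b α) t)
                                   (*-congˡ (ev-monomialOnLine a b α t)))

  ev′-restrictToLine : ∀ a b₁ b₂ b₃ t → let x = line R a (b₁ , b₂ , b₃) t in
    ev′ (restrictToLine a (b₁ , b₂ , b₃)) t
      ≈ b₁ * ∂₁ R q P x + b₂ * ∂₂ R q P x + b₃ * ∂₃ R q P x
  ev′-restrictToLine a b₁ b₂ b₃ t = begin
    ev′ (restrictToLine a b) t
      ≈⟨ sumAₚ-hom (λ p → ev′ p t) refl (λ p p′ → ev′-+ₚ p p′ t) _ ⟩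
    sumA R q (λ α → ev′ (P α ·ₚ monomialOnLine a b α) t)
      ≈⟨ sumA-cong (λ α _ → trans (ev′-·ₚ (P α) (monomialOnLine a b α) t)
                                  (trans (*-congˡ (ev′-monomialOnLine a b₁ b₂ b₃ α t)) (distribute (P α) _ _ _))) ⟩
    sumA R q (λ α → b₁ * D₁ α + b₂ * D₂ α + b₃ * D₃ α)
      ≈⟨ trans (sumA-+ _ _) (+-cong (sumA-+ _ _) (sumA-*ˡ b₃ D₃)) ⟩
    sumA R q (λ α → b₁ * D₁ α) + sumA R q (λ α → b₂ * D₂ α) + b₃ * sumA R q D₃
      ≈⟨ +-congʳ (+-cong (sumA-*ˡ b₁ D₁) (sumA-*ˡ b₂ D₂)) ⟩
    b₁ * sumA R q D₁ + b₂ * sumA R q D₂ + b₃ * sumA R q D₃ ∎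
    where
    b = (b₁ , b₂ , b₃)
    x = line R a b t
    D₁ D₂ D₃ : Exps R → Carrier
    D₁ α = P α * ∂₁monomial α x
    D₂ α = P α * ∂₂monomial α x
    D₃ α = P α * ∂₃monomial α x
    distribute : ∀ c u v w → c * (b₁ * u + b₂ * v + b₃ * w) ≈ b₁ * (c * u) + b₂ * (c * v) + b₃ * (c * w)
    distribute = solve 7 (λ b₁ b₂ b₃ c u v w →
      c :* (b₁ :* u :+ b₂ :* v :+ b₃ :* w) := b₁ :* (c :* u) :+ b₂ :* (c :* v) :+ b₃ :* (c :* w))
      refl b₁ b₂ b₃

  coeff-restrictToLine : ∀ a b k →
    coeff (restrictToLine a b) k ≈ sumA R q (λ α → P α * coeff (monomialOnLine a b α) k)
  coeff-restrictToLine a b k =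
    trans (sumAₚ-hom (λ p → coeff p k) refl (λ p p′ → coeff-+ₚ p p′ k) _)
          (sumA-cong λ α _ → coeff-·ₚ (P α) (monomialOnLine a b α) k)

  restrictToLine-degree : ∀ a b → DegreeBelow (2 ℕ.* q) (restrictToLine a b)
  restrictToLine-degree a b k 2q≤k = trans (coeff-restrictToLine a b k) (sumA-zero λ α (degree<2q , _) →
    trans (*-congˡ (monomialOnLine-degree a b α k (ℕ.≤-trans degree<2q 2q≤k))) (zeroʳ _))

module KakeyaVanishing {c ℓ : Level} (F : CommutativeRing c ℓ) (isField : IsField F)
                       (q : ℕ) (P : Coeffs F) where
  open CommutativeRing F
  open RawSemiring (Semiring.rawSemiring semiring) using (_^_)
  open import Relation.Binary.Reasoning.Setoid setoid
  open FiniteSums F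
  open UnivariatePolynomials F
  open RootCounting F isField
  open LineRestriction F q P

  1^n≈1 : ∀ n → 1# ^ n ≈ 1#
  1^n≈1 zero    = refl
  1^n≈1 (suc n) = trans (*-identityˡ _) (1^n≈1 n)

  VanishingLineInEachDirection : Set (c ⊔ ℓ)
  VanishingLineInEachDirection = ∀ x y → ∃ λ a → ∀ t → VanishesOrder2 F q P (line F a (x , y , 1#) t)

  VanishesFrom : ℕ → Set ℓ
  VanishesFrom d = ∀ α → InA F q α → d ≤ degree α → P α ≈ 0#

  vanishesFrom-2q : VanishesFrom (2 ℕ.* q)
  vanishesFrom-2q α (degree<2q , _) 2q≤degree = ⊥-elim (ℕ.<⇒≱ degree<2q 2q≤degree)

  module _ (e : Fin q → Carrier) (e-inj : Injective _≡_ _≈_ e) where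

    restrictToLine-isZero : ∀ a b₁ b₂ b₃ → (∀ t → VanishesOrder2 F q P (line F a (b₁ , b₂ , b₃) t)) →
                            IsZero (restrictToLine a (b₁ , b₂ , b₃))
    restrictToLine-isZero a b₁ b₂ b₃ vanishes = doubleRoots⇒isZero q e e-inj f degree<q+q
        (λ i → trans (ev-restrictToLine a _ (e i)) (proj₁ (vanishes (e i))))
        (λ i → trans (ev′-restrictToLine a b₁ b₂ b₃ (e i)) (∇≈0 (proj₂ (vanishes (e i)))))
      where
      f = restrictToLine a (b₁ , b₂ , b₃)
      degree<q+q : DegreeBelow (q ℕ.+ q) f
      degree<q+q = ≡.subst (λ n → DegreeBelow n f) (≡.cong (q ℕ.+_) (ℕ.+-identityʳ q))
                           (restrictToLine-degree a (b₁ , b₂ , b₃))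
      ∇≈0 : ∀ {d₁ d₂ d₃} → d₁ ≈ 0# × d₂ ≈ 0# × d₃ ≈ 0# → b₁ * d₁ + b₂ * d₂ + b₃ * d₃ ≈ 0#
      ∇≈0 (d₁≈0 , d₂≈0 , d₃≈0) = begin
        b₁ * _  + b₂ * _  + b₃ * _  ≈⟨ +-cong (+-cong (*-congˡ d₁≈0) (*-congˡ d₂≈0)) (*-congˡ d₃≈0) ⟩
        b₁ * 0# + b₂ * 0# + b₃ * 0# ≈⟨ +-cong (+-cong (zeroʳ b₁) (zeroʳ b₂)) (zeroʳ b₃) ⟩
        0# + 0# + 0#                ≈⟨ trans (+-identityʳ _) (+-identityʳ 0#) ⟩
        0#                          ∎

    module _ (alongLines : VanishingLineInEachDirection) {d} (d<2q : d < 2 ℕ.* q) (above : VanishesFrom (suc d)) where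

      -- For i + j > d this is P (i , j , 0), which is already known to vanish.
      slice : ℕ → ℕ → Carrier
      slice i j = P (i , j , d ∸ (i ℕ.+ j))

      degree≡d⇒k≡d∸[i+j] : ∀ i j {k} → degree (i , j , k) ≡ d → k ≡ d ∸ (i ℕ.+ j)
      degree≡d⇒k≡d∸[i+j] i j {k} degree≡d =
        ≡.trans (≡.sym (ℕ.m+n∸m≡n (i ℕ.+ j) k)) (≡.cong (_∸ (i ℕ.+ j)) degree≡d)

      off-slice-term≈0 : ∀ a b α → InA F q α → degree α ≢ d → P α * coeff (monomialOnLine a b α) d ≈ 0#
      off-slice-term≈0 a b α α∈A degree≢d with ℕ.<-cmp (degree α) d
      ... | tri< degree<d _ _ = trans (*-congˡ (monomialOnLine-degree a b α d degree<d)) (zeroʳ _)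
      ... | tri≈ _ degree≡d _ = ⊥-elim (degree≢d degree≡d)
      ... | tri> _ _ degree>d = trans (*-congʳ (above α α∈A degree>d)) (zeroˡ _)

      sum₃≈slice : ∀ a x y i j → i < q → j < q →
        sumTo F (range₃ i j) (λ k → P (i , j , k) * coeff (monomialOnLine a (x , y , 1#) (i , j , k)) d)
          ≈ slice i j * (x ^ i * y ^ j)
      sum₃≈slice a x y i j i<q j<q with i ℕ.+ j ≤? d
      ... | yes i+j≤d = trans
            (sumTo-single (range₃ i j) k₀ (ℕ.∸-monoˡ-< d<2q i+j≤d)
              (λ k k< k≢k₀ →
                off-slice-term≈0 a _ (i , j , k) (inA i<q j<q k<) (k≢k₀ ∘ degree≡d⇒k≡d∸[i+j] i j)))
            (*-congˡ top)
        where
        k₀ = d ∸ (i ℕ.+ j)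
        M = monomialOnLine a (x , y , 1#) (i , j , k₀)
        top : coeff M d ≈ x ^ i * y ^ j
        top = begin
          coeff M d                         ≡⟨ ≡.cong (coeff M) (ℕ.m+[n∸m]≡n i+j≤d) ⟨
          coeff M (i ℕ.+ j ℕ.+ k₀)          ≈⟨ coeff-monomialOnLine-top a _ (i , j , k₀) ⟩
          x ^ i * y ^ j * 1# ^ k₀           ≈⟨ trans (*-congˡ (1^n≈1 k₀)) (*-identityʳ _) ⟩
          x ^ i * y ^ j                     ∎
      ... | no i+j≰d = trans
            (sumTo-zero (range₃ i j) λ k k< →
              trans (*-congʳ (above _ (inA i<q j<q k<) (d<degree k))) (zeroˡ _))
            (sym (trans (*-congʳ slice≈0) (zeroˡ _)))
        where
        d<i+j = ℕ.≰⇒> i+j≰d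
        d<degree : ∀ k → suc d ≤ i ℕ.+ j ℕ.+ k
        d<degree k = ℕ.≤-trans d<i+j (ℕ.m≤m+n _ k)
        slice≈0 : slice i j ≈ 0#
        slice≈0 = ≡.subst (λ k → P (i , j , k) ≈ 0#) (≡.sym (ℕ.m≤n⇒m∸n≡0 (ℕ.<⇒≤ d<i+j)))
          (above _ (inA i<q j<q (ℕ.m<n⇒0<n∸m (i+j<2q i<q j<q))) (d<degree 0))

      slice≈0 : ∀ i j → i < q → j < q → slice i j ≈ 0#
      slice≈0 = bivariate-roots⇒coeff≈0 q e e-inj slice λ x y →
        let (a , vanishes) = alongLines x y in begin
          sumTo F q (λ i → sumTo F q (λ j → slice i j * (x ^ i * y ^ j)))
            ≈⟨ sumTo-cong q (λ i i<q → sumTo-cong q λ j j<q → sum₃≈slice a x y i j i<q j<q) ⟨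
          sumA F q (λ α → P α * coeff (monomialOnLine a (x , y , 1#) α) d)
            ≈⟨ coeff-restrictToLine a _ d ⟨
          coeff (restrictToLine a (x , y , 1#)) d
            ≈⟨ restrictToLine-isZero a x y 1# vanishes d ⟩
          0# ∎

      vanishesFrom-step : VanishesFrom d
      vanishesFrom-step (i , j , k) α∈A d≤degree with d ℕ.≟ degree (i , j , k)
      ... | no  d≢degree = above _ α∈A (ℕ.≤∧≢⇒< d≤degree d≢degree)
      ... | yes d≡degree =
        ≡.subst (λ k → P (i , j , k) ≈ 0#) (≡.sym (degree≡d⇒k≡d∸[i+j] i j (≡.sym d≡degree)))
                (slice≈0 i j (proj₁ (proj₂ α∈A)) (proj₂ (proj₂ α∈A)))

    isZeroPoly : VanishingLineInEachDirection → IsZeroPoly F q P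
    isZeroPoly alongLines α α∈A =
      downward-induction VanishesFrom (2 ℕ.* q) vanishesFrom-2q (vanishesFrom-step alongLines) α α∈A z≤n

lemma3 : {c ℓ : Level} (q : ℕ) → IsPrimePower q →
    (F : CommutativeRing c ℓ) → IsField F → HasCard F q →
    (K : Point F → Set ℓ) → IsKakeya F K →
    (P : Coeffs F) → (∀ p → K p → VanishesOrder2 F q P p) →
    IsZeroPoly F q P
lemma3 q _ F isField (e , e-inj , _) K kakeya P vanishes =
  KakeyaVanishing.isZeroPoly F isField q P e (λ {i} {j} → e-inj i j) alongLines
  where
  open CommutativeRing F using (1#)
  alongLines : KakeyaVanishing.VanishingLineInEachDirection F isField q P
  alongLines x y with kakeya (x , y , 1#) (λ (_ , _ , 1≈0) → proj₁ isField 1≈0)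
  ... | a , onLine = a , λ t → vanishes _ (onLine t)
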